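{- Let $T$ be the Thue-Morse word and $S$ the period-doubling word. For all $n \geq 2$, \[ \mathcal P^{(1)}_S(n-1) \leq \mathcal P^{(2)}_T(n) \leq 4\, \mathcal P^{(1)}_S(n-1). \]
   Context: The Thue-Morse word $T$ is the fixed point beginning with $0$ of the morphism $\tau(0) = 01$, $\tau(1) = 10$ on $\{0,1\}$. The period-doubling word $S = 0100010101000100\cdots$ is the fixed point of the morphism $\sigma(0) = 01$, $\sigma(1) = 00$. For a finite word $u$ and nonempty word $x$, $|u|_x$ is the number of occurrences of $x$ as a factor of $u$; $u, v$ are $k$-Abelian equivalent if $|u|_x = |v|_x$ for all nonempty $x$ of length at most $k$. For an infinite word $w$, $\mathcal P^{(k)}_w(n)$ is the number of $k$-Abelian equivalence classes among the factors of $w$ of length $n$. -}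

module Defs where

open import Data.Bool using (Bool; true; false)
open import Data.Bool.Properties using () renaming (_≟_ to _≟B_)
open import Data.Nat using (ℕ; zero; suc; _+_; _≤_; _<_)
open import Data.List using (List; []; _∷_; length; map; concatMap; upTo; take; drop; filter)
open import Data.List.Properties using (≡-dec)
open import Data.List.Relation.Unary.All using (All)
open import Data.List.Relation.Unary.Any using (Any)
open import Data.List.Relation.Unary.AllPairs using (AllPairs)
open import Data.Product using (Σ; ∃; _×_)
open import Relation.Nullary using (¬_; Dec)
open import Relation.Binary.PropositionalEquality using (_≡_)

-- Letters: 0 is false, 1 is true.
Word : Set
Word = List Bool

InfWord : Set
InfWord = ℕ → Bool

_≟W_ : (u v : Word) → Dec (u ≡ v)
_≟W_ = ≡-dec _≟B_

applyMorph : (Bool → Word) → Word → Word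
applyMorph f = concatMap f

iterMorph : (Bool → Word) → ℕ → Word → Word
iterMorph f zero    u = u
iterMorph f (suc m) u = applyMorph f (iterMorph f m u)

-- lookup with default letter false (only used in-range below)
lookupD : Word → ℕ → Bool
lookupD []       _       = false
lookupD (a ∷ u)  zero    = a
lookupD (a ∷ u)  (suc i) = lookupD u i

-- fixed point beginning with a letter of a prolongable morphism:
-- the i-th letter is the i-th letter of f^(i+1)(a)
-- (for the two morphisms below |f^(i+1)(a)| = 2^(i+1) > i).
fixedPoint : (Bool → Word) → Bool → InfWord
fixedPoint f a i = lookupD (iterMorph f (suc i) (a ∷ [])) i

τ : Bool → Word
τ false = false ∷ true ∷ []
τ true  = true ∷ false ∷ []

σ : Bool → Word
σ false = false ∷ true ∷ []
σ true  = false ∷ false ∷ []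

ThueMorse : InfWord
ThueMorse = fixedPoint τ false

PeriodDoubling : InfWord
PeriodDoubling = fixedPoint σ false

factor : InfWord → ℕ → ℕ → Word
factor w i n = map (λ j → w (i + j)) (upTo n)

occ : Word → Word → ℕ
occ x u = length (filter (λ j → take (length x) (drop j u) ≟W x) (upTo (length u)))

KAbelianEq : ℕ → Word → Word → Set
KAbelianEq k u v = (x : Word) → 1 ≤ length x → length x ≤ k → occ x u ≡ occ x v

IsFactor : InfWord → ℕ → Word → Set
IsFactor w n u = ∃ λ i → factor w i n ≡ u

-- P^(k)_w(n) = c : there is a list of c factors of w of length n,
-- pairwise non-k-Abelian-equivalent, such that every factor of length n
-- is k-Abelian equivalent to one of them (a system of class representatives).
KAbelianComplexityIs : InfWord → ℕ → ℕ → ℕ → Set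
KAbelianComplexityIs w k n c =
  Σ (List Word) λ L →
      length L ≡ c
    × All (IsFactor w n) L
    × AllPairs (λ u v → ¬ KAbelianEq k u v) L
    × ((i : ℕ) → Any (KAbelianEq k (factor w i n)) L)

-- Let u be the factor of T of length n at position p and v the factor of S of length n − 1 at p.
-- Since S i = 1 exactly when T i = T (i + 1), the letters 0 and 1 of v count the changes
-- (01, 10) and the squares (00, 11) of u, so the Abelian class of v is a function of the
-- 2-Abelian class of u. Conversely, the 2-Abelian class of a binary word is determined by its
-- first letter and its four pair counts. In any binary word the changes 01 and 10 alternate, so
-- their counts are determined by their sum and the first letter; in T the squares sit at odd
-- positions, so adding the alternating word 0101… turns them into changes, and their counts are
-- determined by their sum and one more bit. Hence the 2-Abelian class of u is determined by the
-- Abelian class of v and two bits, which gives the factor 4. Finitely many positions suffice to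
-- exhibit all classes, since every factor of T of length 2^k occurs before position 6 · 2^k.

module Submission where

open import Defs
open import Data.Bool using (Bool; true; false; not; _xor_; _∧_; _∨_; if_then_else_)
open import Data.Bool.Properties
  using (not-distribʳ-xor; xor-identityʳ; ∧-zeroʳ; ∧-identityʳ; ∨-identityʳ; not-¬)
  renaming (_≟_ to _≟ᵇ_)
open import Data.Empty using (⊥-elim)
open import Data.List
  using (List; []; _∷_; length; map; concat; _++_; take; filter; upTo; applyUpTo; deduplicate; cartesianProduct)
open import Data.List.Properties
  using ( map-++; concat-++; length-++; length-map; map-upTo; map-∘; map-cong; map-cong-local
        ; ∷-injectiveˡ; ∷-injectiveʳ; length-removeAt′)
  renaming (≡-dec to List-≡-dec)
open import Data.List.Membership.Propositional using (_∈_)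
open import Data.List.Membership.Propositional.Properties
  using (∈-map⁺; ∈-map⁻; ∈-++⁺ˡ; ∈-++⁺ʳ; ∈-upTo⁺; ∈-upTo⁻; ∈-cartesianProduct⁺)
import Data.List.Membership.Setoid.Properties as SetoidMembership
open import Data.List.Relation.Binary.Subset.Propositional using (_⊆_)
open import Data.List.Relation.Unary.All as All using (All; []; _∷_)
import Data.List.Relation.Unary.All.Properties as All
open import Data.List.Relation.Unary.Any as Any using (Any; here; there; _─_; index)
import Data.List.Relation.Unary.Any.Properties as Any
open import Data.List.Relation.Unary.AllPairs as AllPairs using (AllPairs; []; _∷_)
import Data.List.Relation.Unary.AllPairs.Properties as AllPairs
open import Data.List.Relation.Unary.Unique.Propositional using (Unique)
open import Data.List.Relation.Unary.Unique.DecSetoid.Properties using (deduplicate-!)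
open import Data.Nat
  using (ℕ; zero; suc; _+_; _*_; _^_; _∸_; _≤_; _<_; z≤n; s≤s; z<s; s<s; _<?_; NonZero; ⌊_/2⌋; ⌈_/2⌉)
open import Data.Nat.Properties
open import Data.Nat.DivMod using (_/_; _%_; m≡m%n+[m/n]*n; m%n<n)
open import Data.Nat.Induction using (<-rec)
open import Data.Nat.Tactic.RingSolver using (solve-∀)
open import Data.Product using (Σ; ∃; _×_; _,_; proj₁; proj₂)
open import Data.Sum using (_⊎_; inj₁; inj₂)
open import Function using (_∘_; id)
open import Relation.Binary.Bundles using (DecSetoid)
import Relation.Binary.Construct.On as On
open import Relation.Binary.PropositionalEquality
open import Relation.Nullary using (¬_; does; yes; no)
open import Relation.Unary using (Decidable)

data EvenOdd : ℕ → Set where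
  even : ∀ k → EvenOdd (2 * k)
  odd  : ∀ k → EvenOdd (suc (2 * k))

evenOdd : ∀ n → EvenOdd n
evenOdd zero = even 0
evenOdd (suc n) with evenOdd n
... | even k = odd k
... | odd k  = subst EvenOdd (*-suc 2 k) (even (suc k))

halving-induction : (P : ℕ → Set) → (∀ k → P (2 * k)) → (∀ k → P k → P (suc (2 * k))) →
                    ∀ n → P n
halving-induction P P-even P-odd = <-rec P step
  where
  step : ∀ n → (∀ {m} → m < n → P m) → P n
  step n rec with evenOdd n
  ... | even k = P-even k
  ... | odd k  = P-odd k (rec (s≤s (m≤n*m k 2)))

n<2^n : ∀ n → n < 2 ^ n
n<2^n zero    = s≤s z≤n
n<2^n (suc n) = +-mono-≤ (m^n>0 2 n) (≤-trans (n<2^n n) (m≤m+n _ 0))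

2*-mono-< : ∀ {m n} → m < n → suc (2 * m) < 2 * n
2*-mono-< {m} {n} m<n = subst (_≤ 2 * n) (*-suc 2 m) (*-monoʳ-≤ 2 m<n)

private
  variable
    A B C : Set

∈-─ : ∀ {x y} {ys : List A} (x∈ys : x ∈ ys) → y ∈ ys → y ≢ x → y ∈ (ys ─ x∈ys)
∈-─ (here refl)  (here refl)  y≢x = ⊥-elim (y≢x refl)
∈-─ (here _)     (there y∈ys) _   = y∈ys
∈-─ (there _)    (here refl)  _   = here refl
∈-─ (there x∈ys) (there y∈ys) y≢x = there (∈-─ x∈ys y∈ys y≢x)

unique-⊆⇒length-≤ : ∀ {xs ys : List A} → Unique xs → xs ⊆ ys → length xs ≤ length ys
unique-⊆⇒length-≤ {xs = []} _ _ = z≤n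
unique-⊆⇒length-≤ {xs = x ∷ xs} {ys} (x∉xs ∷ xs!) x∷xs⊆ys =
  subst (suc (length xs) ≤_) (sym (length-removeAt′ ys (index x∈ys))) (s≤s (unique-⊆⇒length-≤ xs! xs⊆ys─x))
  where
  x∈ys : x ∈ ys
  x∈ys = x∷xs⊆ys (here refl)
  xs⊆ys─x : xs ⊆ (ys ─ x∈ys)
  xs⊆ys─x y∈xs = ∈-─ x∈ys (x∷xs⊆ys (there y∈xs)) (≢-sym (All.lookup x∉xs y∈xs))

length-cartesianProduct : ∀ (xs : List A) (ys : List B) → length (cartesianProduct xs ys) ≡ length xs * length ys
length-cartesianProduct []       ys = refl
length-cartesianProduct (x ∷ xs) ys =
  trans (length-++ (map (x ,_) ys)) (cong₂ _+_ (length-map (x ,_) ys) (length-cartesianProduct xs ys))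

map-⊆ : ∀ {f : A → B} {xs ys} → (∀ x → f x ∈ ys) → map f xs ⊆ ys
map-⊆ {f = f} f∈ys y∈ with ∈-map⁻ f y∈
... | x , _ , refl = f∈ys x

∈-map-through : ∀ (f : A → B) (g : A → C) → (∀ x y → g x ≡ g y → f x ≡ f y) →
                ∀ {ys} x → g x ∈ map g ys → f x ∈ map f ys
∈-map-through f g f-through-g x gx∈ with ∈-map⁻ g gx∈
... | y , y∈ys , gx≡gy = subst (_∈ map f _) (sym (f-through-g _ y gx≡gy)) (∈-map⁺ f y∈ys)

map≡map⇒≡ : ∀ {f g : A → B} {xs x} → map f xs ≡ map g xs → x ∈ xs → f x ≡ g x
map≡map⇒≡ {xs = _ ∷ _} eq (here refl) = ∷-injectiveˡ eq
map≡map⇒≡ {xs = _ ∷ _} eq (there x∈)  = map≡map⇒≡ (∷-injectiveʳ eq) x∈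

length-filter-applyUpTo : ∀ {P : ℕ → Set} (P? : Decidable P) f n →
  length (filter P? (applyUpTo f n)) ≡ length (filter (P? ∘ f) (upTo n))
length-filter-applyUpTo P? f zero = refl
length-filter-applyUpTo P? f (suc n) with does (P? (f 0))
... | true  = cong suc (trans (length-filter-applyUpTo P? (f ∘ suc) n)
                             (sym (length-filter-applyUpTo (P? ∘ f) suc n)))
... | false = trans (length-filter-applyUpTo P? (f ∘ suc) n)
                    (sym (length-filter-applyUpTo (P? ∘ f) suc n))

-- Fixed points of 2-uniform morphisms

lookupD-++ : ∀ u v {i} → i < length u → lookupD (u ++ v) i ≡ lookupD u i
lookupD-++ (a ∷ u) v {zero}  _         = refl
lookupD-++ (a ∷ u) v {suc i} (s≤s i<u) = lookupD-++ u v i<u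

applyMorph-++ : ∀ f u v → applyMorph f (u ++ v) ≡ applyMorph f u ++ applyMorph f v
applyMorph-++ f u v = trans (cong concat (map-++ f u v)) (sym (concat-++ (map f u) (map f v)))

module TwoUniform (f : Bool → Word) (g₀ g₁ : Bool → Bool) (f≡ : ∀ b → f b ≡ g₀ b ∷ g₁ b ∷ [])
                  (a : Bool) (g₀a≡a : g₀ a ≡ a) where

  length-applyMorph : ∀ u → length (applyMorph f u) ≡ 2 * length u
  length-applyMorph []      = refl
  length-applyMorph (b ∷ u) rewrite f≡ b | length-applyMorph u = sym (*-suc 2 (length u))

  lookup-applyMorph : ∀ u {j} → j < length u →
    lookupD (applyMorph f u) (2 * j) ≡ g₀ (lookupD u j) ×
    lookupD (applyMorph f u) (suc (2 * j)) ≡ g₁ (lookupD u j)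
  lookup-applyMorph (b ∷ u) {zero}  _ rewrite f≡ b = refl , refl
  lookup-applyMorph (b ∷ u) {suc j} (s≤s j<u) rewrite f≡ b with lookup-applyMorph u j<u
  ... | IH₀ , IH₁ = trans (cong (lookupD image) (*-suc 2 j)) IH₀ ,
                    trans (cong (lookupD image ∘ suc) (*-suc 2 j)) IH₁
    where
    image : Word
    image = g₀ b ∷ g₁ b ∷ applyMorph f u

  orbit : ℕ → Word
  orbit k = iterMorph f k (a ∷ [])

  length-orbit : ∀ k → length (orbit k) ≡ 2 ^ k
  length-orbit zero    = refl
  length-orbit (suc k) = trans (length-applyMorph (orbit k)) (cong (2 *_) (length-orbit k))

  orbit-prefix : ∀ k → ∃ λ v → orbit (suc k) ≡ orbit k ++ v
  orbit-prefix zero rewrite f≡ a | g₀a≡a = g₁ a ∷ [] , refl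
  orbit-prefix (suc k) with orbit-prefix k
  ... | v , eq = applyMorph f v , trans (cong (applyMorph f) eq) (applyMorph-++ f (orbit k) v)

  lookup-orbit-stable : ∀ k d {i} → i < 2 ^ k → lookupD (orbit (d + k)) i ≡ lookupD (orbit k) i
  lookup-orbit-stable k zero    i<2^k = refl
  lookup-orbit-stable k (suc d) {i} i<2^k with orbit-prefix (d + k)
  ... | v , eq = begin
    lookupD (orbit (suc d + k)) i     ≡⟨ cong (λ u → lookupD u i) eq ⟩
    lookupD (orbit (d + k) ++ v) i    ≡⟨ lookupD-++ (orbit (d + k)) v i<orbit ⟩
    lookupD (orbit (d + k)) i         ≡⟨ lookup-orbit-stable k d i<2^k ⟩
    lookupD (orbit k) i               ∎
    where
    open ≡-Reasoning
    i<orbit : i < length (orbit (d + k))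
    i<orbit = subst (i <_) (sym (length-orbit (d + k)))
                (<-≤-trans i<2^k (^-monoʳ-≤ 2 (m≤n+m k d)))

  fixedPoint-orbit : ∀ k {i} → i < 2 ^ k → fixedPoint f a i ≡ lookupD (orbit k) i
  fixedPoint-orbit k {i} i<2^k = begin
    lookupD (orbit (suc i)) i      ≡⟨ lookup-orbit-stable (suc i) k i<2^1+i ⟨
    lookupD (orbit (k + suc i)) i  ≡⟨ cong (λ e → lookupD (orbit e) i) (+-comm k (suc i)) ⟩
    lookupD (orbit (suc i + k)) i  ≡⟨ lookup-orbit-stable k (suc i) i<2^k ⟩
    lookupD (orbit k) i            ∎
    where
    open ≡-Reasoning
    i<2^1+i : i < 2 ^ suc i
    i<2^1+i = <-trans (n<2^n i) (^-monoʳ-< 2 (s≤s (s≤s z≤n)) (n<1+n i))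

  private
    j<length-orbit : ∀ j → j < length (orbit j)
    j<length-orbit j = subst (j <_) (sym (length-orbit j)) (n<2^n j)

  fixedPoint-even : ∀ j → fixedPoint f a (2 * j) ≡ g₀ (fixedPoint f a j)
  fixedPoint-even j = begin
    fixedPoint f a (2 * j)              ≡⟨ fixedPoint-orbit (suc j) (<-trans (n<1+n _) (2*-mono-< (n<2^n j))) ⟩
    lookupD (orbit (suc j)) (2 * j)     ≡⟨ proj₁ (lookup-applyMorph (orbit j) (j<length-orbit j)) ⟩
    g₀ (lookupD (orbit j) j)            ≡⟨ cong g₀ (fixedPoint-orbit j (n<2^n j)) ⟨
    g₀ (fixedPoint f a j)               ∎
    where open ≡-Reasoning

  fixedPoint-odd : ∀ j → fixedPoint f a (suc (2 * j)) ≡ g₁ (fixedPoint f a j)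
  fixedPoint-odd j = begin
    fixedPoint f a (suc (2 * j))           ≡⟨ fixedPoint-orbit (suc j) (2*-mono-< (n<2^n j)) ⟩
    lookupD (orbit (suc j)) (suc (2 * j))  ≡⟨ proj₂ (lookup-applyMorph (orbit j) (j<length-orbit j)) ⟩
    g₁ (lookupD (orbit j) j)               ≡⟨ cong g₁ (fixedPoint-orbit j (n<2^n j)) ⟨
    g₁ (fixedPoint f a j)                  ∎
    where open ≡-Reasoning

-- Thue–Morse and period doubling

τ≡ : ∀ b → τ b ≡ b ∷ not b ∷ []
τ≡ false = refl
τ≡ true  = refl

σ≡ : ∀ b → σ b ≡ false ∷ not b ∷ []
σ≡ false = refl
σ≡ true  = refl

module ThueMorseMorphism      = TwoUniform τ id not τ≡ false refl
module PeriodDoublingMorphism = TwoUniform σ (λ _ → false) not σ≡ false refl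

thueMorse-even : ∀ j → ThueMorse (2 * j) ≡ ThueMorse j
thueMorse-even = ThueMorseMorphism.fixedPoint-even

thueMorse-odd : ∀ j → ThueMorse (suc (2 * j)) ≡ not (ThueMorse j)
thueMorse-odd = ThueMorseMorphism.fixedPoint-odd

periodDoubling-even : ∀ j → PeriodDoubling (2 * j) ≡ false
periodDoubling-even = PeriodDoublingMorphism.fixedPoint-even

periodDoubling-odd : ∀ j → PeriodDoubling (suc (2 * j)) ≡ not (PeriodDoubling j)
periodDoubling-odd = PeriodDoublingMorphism.fixedPoint-odd

periodDoubling≡thueMorse-equal : ∀ i → PeriodDoubling i ≡ does (ThueMorse i ≟ᵇ ThueMorse (suc i))
periodDoubling≡thueMorse-equal = halving-induction _ even-case odd-case
  where
  ≟-not : ∀ b → false ≡ does (b ≟ᵇ not b)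
  ≟-not false = refl
  ≟-not true  = refl

  not-≟ : ∀ b c → not (does (b ≟ᵇ c)) ≡ does (not b ≟ᵇ c)
  not-≟ false false = refl
  not-≟ false true  = refl
  not-≟ true  false = refl
  not-≟ true  true  = refl

  thueMorse-2+2* : ∀ k → ThueMorse (suc (suc (2 * k))) ≡ ThueMorse (suc k)
  thueMorse-2+2* k = trans (cong ThueMorse (sym (*-suc 2 k))) (thueMorse-even (suc k))

  even-case : ∀ k → PeriodDoubling (2 * k) ≡ does (ThueMorse (2 * k) ≟ᵇ ThueMorse (suc (2 * k)))
  even-case k rewrite periodDoubling-even k | thueMorse-even k | thueMorse-odd k = ≟-not (ThueMorse k)

  odd-case : ∀ k → PeriodDoubling k ≡ does (ThueMorse k ≟ᵇ ThueMorse (suc k)) →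
             PeriodDoubling (suc (2 * k)) ≡ does (ThueMorse (suc (2 * k)) ≟ᵇ ThueMorse (suc (suc (2 * k))))
  odd-case k IH rewrite periodDoubling-odd k | thueMorse-odd k | thueMorse-2+2* k | IH =
    not-≟ (ThueMorse k) (ThueMorse (suc k))

thueMorse-block : ∀ k q {i} → i < 2 ^ k → ThueMorse (2 ^ k * q + i) ≡ ThueMorse q xor ThueMorse i
thueMorse-block zero q {zero} _ = begin
  ThueMorse (1 * q + 0)   ≡⟨ cong ThueMorse (trans (+-identityʳ (1 * q)) (*-identityˡ q)) ⟩
  ThueMorse q             ≡⟨ xor-identityʳ (ThueMorse q) ⟨
  ThueMorse q xor false   ∎
  where open ≡-Reasoning
thueMorse-block zero q {suc i} (s≤s ())
thueMorse-block (suc k) q {i} i<2^1+k with evenOdd i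
... | even j = begin
  ThueMorse (2 ^ suc k * q + 2 * j)   ≡⟨ cong ThueMorse (double (2 ^ k) q j) ⟩
  ThueMorse (2 * (2 ^ k * q + j))     ≡⟨ thueMorse-even (2 ^ k * q + j) ⟩
  ThueMorse (2 ^ k * q + j)           ≡⟨ thueMorse-block k q j<2^k ⟩
  ThueMorse q xor ThueMorse j         ≡⟨ cong (ThueMorse q xor_) (thueMorse-even j) ⟨
  ThueMorse q xor ThueMorse (2 * j)   ∎
  where
  open ≡-Reasoning
  double : ∀ M q j → 2 * M * q + 2 * j ≡ 2 * (M * q + j)
  double = solve-∀
  j<2^k : j < 2 ^ k
  j<2^k = *-cancelˡ-< 2 j (2 ^ k) i<2^1+k
... | odd j = begin
  ThueMorse (2 ^ suc k * q + suc (2 * j))   ≡⟨ cong ThueMorse (double+1 (2 ^ k) q j) ⟩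
  ThueMorse (suc (2 * (2 ^ k * q + j)))     ≡⟨ thueMorse-odd (2 ^ k * q + j) ⟩
  not (ThueMorse (2 ^ k * q + j))           ≡⟨ cong not (thueMorse-block k q j<2^k) ⟩
  not (ThueMorse q xor ThueMorse j)         ≡⟨ not-distribʳ-xor (ThueMorse q) (ThueMorse j) ⟩
  ThueMorse q xor not (ThueMorse j)         ≡⟨ cong (ThueMorse q xor_) (thueMorse-odd j) ⟨
  ThueMorse q xor ThueMorse (suc (2 * j))   ∎
  where
  open ≡-Reasoning
  double+1 : ∀ M q j → 2 * M * q + suc (2 * j) ≡ suc (2 * (M * q + j))
  double+1 = solve-∀
  j<2^k : j < 2 ^ k
  j<2^k = *-cancelˡ-< 2 j (2 ^ k) (<-trans (n<1+n _) i<2^1+k)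

thueMorse-twoBlocks : ∀ k {q q′} → ThueMorse q ≡ ThueMorse q′ → ThueMorse (suc q) ≡ ThueMorse (suc q′) →
                      ∀ {s} → s < 2 ^ k + 2 ^ k → ThueMorse (2 ^ k * q + s) ≡ ThueMorse (2 ^ k * q′ + s)
thueMorse-twoBlocks k {q} {q′} T₀ T₁ {s} s<2M with s <? 2 ^ k
... | yes s<M = begin
  ThueMorse (2 ^ k * q + s)     ≡⟨ thueMorse-block k q s<M ⟩
  ThueMorse q xor ThueMorse s   ≡⟨ cong (_xor ThueMorse s) T₀ ⟩
  ThueMorse q′ xor ThueMorse s  ≡⟨ thueMorse-block k q′ s<M ⟨
  ThueMorse (2 ^ k * q′ + s)    ∎
  where open ≡-Reasoning
... | no s≮M = begin
  ThueMorse (M * q + s)              ≡⟨ cong ThueMorse (next-block q) ⟩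
  ThueMorse (M * suc q + t)          ≡⟨ thueMorse-block k (suc q) t<M ⟩
  ThueMorse (suc q) xor ThueMorse t  ≡⟨ cong (_xor ThueMorse t) T₁ ⟩
  ThueMorse (suc q′) xor ThueMorse t ≡⟨ thueMorse-block k (suc q′) t<M ⟨
  ThueMorse (M * suc q′ + t)         ≡⟨ cong ThueMorse (next-block q′) ⟨
  ThueMorse (M * q′ + s)             ∎
  where
  open ≡-Reasoning
  M t : ℕ
  M = 2 ^ k
  t = s ∸ M
  s≡M+t : s ≡ M + t
  s≡M+t = sym (m+[n∸m]≡n (≮⇒≥ s≮M))
  t<M : t < M
  t<M = +-cancelˡ-< M t M (subst (_< M + M) s≡M+t s<2M)
  shift : ∀ M x t → M * x + (M + t) ≡ M * suc x + t
  shift = solve-∀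
  next-block : ∀ x → M * x + s ≡ M * suc x + t
  next-block x = trans (cong (M * x +_) s≡M+t) (shift M x t)

thueMorse-pair-early : ∀ q → ∃ λ q′ → q′ < 6 × ThueMorse q ≡ ThueMorse q′ × ThueMorse (suc q) ≡ ThueMorse (suc q′)
thueMorse-pair-early q with ThueMorse q | ThueMorse (suc q)
... | false | false = 5 , ≤-refl , refl , refl
... | false | true  = 0 , z<s , refl , refl
... | true  | false = 2 , s<s (s<s z<s) , refl , refl
... | true  | true  = 1 , s<s z<s , refl , refl

thueMorse-recurrent : ∀ k i → ∃ λ p → p < 2 ^ k * 6 ×
                      (∀ {j} → j < 2 ^ k → ThueMorse (i + j) ≡ ThueMorse (p + j))
thueMorse-recurrent k i = move-to-early-block (thueMorse-pair-early q)
  where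
  M q r : ℕ
  M = 2 ^ k
  instance
    M≢0 : NonZero M
    M≢0 = m^n≢0 2 k
  q = i / M
  r = i % M
  r<M : r < M
  r<M = m%n<n i M
  regroup : ∀ r q M j → r + q * M + j ≡ M * q + (r + j)
  regroup = solve-∀
  move-to-early-block : (∃ λ q′ → q′ < 6 × ThueMorse q ≡ ThueMorse q′ × ThueMorse (suc q) ≡ ThueMorse (suc q′)) →
                        ∃ λ p → p < M * 6 × (∀ {j} → j < M → ThueMorse (i + j) ≡ ThueMorse (p + j))
  move-to-early-block (q′ , q′<6 , T₀ , T₁) = M * q′ + r , p<M*6 , agree
    where
    p<M*6 : M * q′ + r < M * 6
    p<M*6 = begin-strict
      M * q′ + r   <⟨ +-monoʳ-< (M * q′) r<M ⟩
      M * q′ + M   ≡⟨ +-comm (M * q′) M ⟩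
      M + M * q′   ≡⟨ *-suc M q′ ⟨
      M * suc q′   ≤⟨ *-monoʳ-≤ M q′<6 ⟩
      M * 6        ∎
      where open ≤-Reasoning
    agree : ∀ {j} → j < M → ThueMorse (i + j) ≡ ThueMorse (M * q′ + r + j)
    agree {j} j<M = begin
      ThueMorse (i + j)              ≡⟨ cong (λ x → ThueMorse (x + j)) (m≡m%n+[m/n]*n i M) ⟩
      ThueMorse (r + q * M + j)      ≡⟨ cong ThueMorse (regroup r q M j) ⟩
      ThueMorse (M * q + (r + j))    ≡⟨ thueMorse-twoBlocks k T₀ T₁ (+-mono-< r<M j<M) ⟩
      ThueMorse (M * q′ + (r + j))   ≡⟨ cong ThueMorse (+-assoc (M * q′) r j) ⟨
      ThueMorse (M * q′ + r + j)     ∎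
      where open ≡-Reasoning

factor-cong : ∀ (w : InfWord) n {i p} → (∀ {j} → j < n → w (i + j) ≡ w (p + j)) →
              factor w i n ≡ factor w p n
factor-cong w n agree = map-cong-local (All.tabulate (agree ∘ ∈-upTo⁻))

thueMorse-factor-recurrent : ∀ n i → ∃ λ p → p < 2 ^ n * 6 × factor ThueMorse i n ≡ factor ThueMorse p n
thueMorse-factor-recurrent n i with thueMorse-recurrent n i
... | p , p<B , agree = p , p<B , factor-cong ThueMorse n {i} {p} (λ j<n → agree (<-trans j<n (n<2^n n)))

periodDoubling-factor-recurrent : ∀ n i → ∃ λ p → p < 2 ^ suc n * 6 ×
                                  factor PeriodDoubling i n ≡ factor PeriodDoubling p n
periodDoubling-factor-recurrent n i with thueMorse-recurrent (suc n) i
... | p , p<B , agree = p , p<B , factor-cong PeriodDoubling n {i} {p} agreeS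
  where
  agreeT : ∀ {j} → j < suc n → ThueMorse (i + j) ≡ ThueMorse (p + j)
  agreeT j<1+n = agree (<-trans j<1+n (n<2^n (suc n)))
  agreeS : ∀ {j} → j < n → PeriodDoubling (i + j) ≡ PeriodDoubling (p + j)
  agreeS {j} j<n = begin
    PeriodDoubling (i + j)                               ≡⟨ periodDoubling≡thueMorse-equal (i + j) ⟩
    does (ThueMorse (i + j) ≟ᵇ ThueMorse (suc (i + j)))
      ≡⟨ cong₂ (λ a b → does (a ≟ᵇ b)) (agreeT (m<n⇒m<1+n j<n)) next ⟩
    does (ThueMorse (p + j) ≟ᵇ ThueMorse (suc (p + j)))   ≡⟨ periodDoubling≡thueMorse-equal (p + j) ⟨
    PeriodDoubling (p + j)                               ∎
    where
    open ≡-Reasoning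
    next : ThueMorse (suc (i + j)) ≡ ThueMorse (suc (p + j))
    next = begin
      ThueMorse (suc (i + j))  ≡⟨ cong ThueMorse (+-suc i j) ⟨
      ThueMorse (i + suc j)    ≡⟨ agreeT (s<s j<n) ⟩
      ThueMorse (p + suc j)    ≡⟨ cong ThueMorse (+-suc p j) ⟩
      ThueMorse (suc (p + j))  ∎

-- Letters and pairs in factors

indicator : Bool → ℕ
indicator b = if b then 1 else 0

occ-∷ : ∀ x a u → occ x (a ∷ u) ≡ indicator (does (take (length x) (a ∷ u) ≟W x)) + occ x u
occ-∷ x a u with does (take (length x) (a ∷ u) ≟W x)
... | true  = cong suc (length-filter-applyUpTo _ suc (length u))
... | false = length-filter-applyUpTo _ suc (length u)

count : (ℕ → Bool) → ℕ → ℕ → ℕ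
count P p zero    = 0
count P p (suc m) = indicator (P p) + count P (suc p) m

count-cong : ∀ {P Q} → (∀ i → P i ≡ Q i) → ∀ p m → count P p m ≡ count Q p m
count-cong P≡Q p zero    = refl
count-cong P≡Q p (suc m) = cong₂ (λ b c → indicator b + c) (P≡Q p) (count-cong P≡Q (suc p) m)

count-shift : ∀ P p m → count P (suc p) m ≡ count (P ∘ suc) p m
count-shift P p zero    = refl
count-shift P p (suc m) = cong (indicator (P (suc p)) +_) (count-shift P (suc p) m)

count-∨ : ∀ {P Q} → (∀ i → P i ∧ Q i ≡ false) → ∀ p m →
          count (λ i → P i ∨ Q i) p m ≡ count P p m + count Q p m
count-∨ disjoint p zero = refl
count-∨ {P} {Q} disjoint p (suc m) with P p | Q p | disjoint p | count-∨ disjoint (suc p) m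
... | true  | false | _ | IH = cong suc IH
... | false | true  | _ | IH = trans (cong suc IH) (sym (+-suc (count P (suc p) m) _))
... | false | false | _ | IH = IH

letterAt : InfWord → Bool → ℕ → Bool
letterAt w b i = does (w i ≟ᵇ b)

pairAt : InfWord → Bool → Bool → ℕ → Bool
pairAt w b b′ i = letterAt w b i ∧ letterAt w b′ (suc i)

factor-suc : ∀ w p n → factor w p (suc n) ≡ w p ∷ factor w (suc p) n
factor-suc w p n = cong₂ _∷_ (cong w (+-identityʳ p)) (begin
  map (λ j → w (p + j)) (applyUpTo suc n)      ≡⟨ cong (map (λ j → w (p + j))) (map-upTo suc n) ⟨
  map (λ j → w (p + j)) (map suc (upTo n))     ≡⟨ map-∘ (upTo n) ⟨
  map (λ j → w (p + suc j)) (upTo n)           ≡⟨ map-cong (λ j → cong w (+-suc p j)) (upTo n) ⟩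
  map (λ j → w (suc p + j)) (upTo n)           ∎)
  where open ≡-Reasoning

occ-letter : ∀ w b p n → occ (b ∷ []) (factor w p n) ≡ count (letterAt w b) p n
occ-letter w b p zero    = refl
occ-letter w b p (suc n) = begin
  occ (b ∷ []) (factor w p (suc n))                                  ≡⟨ cong (occ (b ∷ [])) (factor-suc w p n) ⟩
  occ (b ∷ []) (w p ∷ factor w (suc p) n)                            ≡⟨ occ-∷ (b ∷ []) (w p) _ ⟩
  indicator (letterAt w b p ∧ true) + occ (b ∷ []) (factor w (suc p) n)
    ≡⟨ cong₂ (λ c k → indicator c + k) (∧-identityʳ _) (occ-letter w b (suc p) n) ⟩
  count (letterAt w b) p (suc n)                                     ∎
  where open ≡-Reasoning

occ-pair : ∀ w b b′ p m → occ (b ∷ b′ ∷ []) (factor w p (suc m)) ≡ count (pairAt w b b′) p m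
occ-pair w b b′ p zero = begin
  occ (b ∷ b′ ∷ []) (factor w p 1)                            ≡⟨ cong (occ (b ∷ b′ ∷ [])) (factor-suc w p 0) ⟩
  occ (b ∷ b′ ∷ []) (w p ∷ [])                                ≡⟨ occ-∷ (b ∷ b′ ∷ []) (w p) [] ⟩
  indicator (letterAt w b p ∧ false) + 0               ≡⟨ cong (λ c → indicator c + 0) (∧-zeroʳ _) ⟩
  0                                                           ∎
  where open ≡-Reasoning
occ-pair w b b′ p (suc m) = begin
  occ x (factor w p (suc (suc m)))                                        ≡⟨ cong (occ x) (factor-suc w p (suc m)) ⟩
  occ x (w p ∷ factor w (suc p) (suc m))                                  ≡⟨ occ-∷ x (w p) _ ⟩
  indicator (starts-x (factor w (suc p) (suc m))) + occ x (factor w (suc p) (suc m))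
    ≡⟨ cong₂ (λ c k → indicator c + k) head (occ-pair w b b′ (suc p) m) ⟩
  count (pairAt w b b′) p (suc m)                                         ∎
  where
  open ≡-Reasoning
  x : Word
  x = b ∷ b′ ∷ []
  starts-x : Word → Bool
  starts-x u = does (take 2 (w p ∷ u) ≟W x)
  head : starts-x (factor w (suc p) (suc m)) ≡ pairAt w b b′ p
  head = trans (cong starts-x (factor-suc w (suc p) m)) (cong (letterAt w b p ∧_) (∧-identityʳ _))

pairAt-disjoint : ∀ w b c i → pairAt w false b i ∧ pairAt w true c i ≡ false
pairAt-disjoint w b c i with w i
... | false = ∧-zeroʳ _
... | true  = refl

letterAt≡pairAt∨pairAt : ∀ w b i → letterAt w b (suc i) ≡ pairAt w false b i ∨ pairAt w true b i
letterAt≡pairAt∨pairAt w b i with w i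
... | false = sym (∨-identityʳ _)
... | true  = refl

count-letter-by-predecessor : ∀ w b p m →
  count (letterAt w b) p (suc m) ≡ indicator (letterAt w b p) + (count (pairAt w false b) p m + count (pairAt w true b) p m)
count-letter-by-predecessor w b p m = cong (indicator (letterAt w b p) +_) (begin
  count (letterAt w b) (suc p) m                              ≡⟨ count-shift (letterAt w b) p m ⟩
  count (letterAt w b ∘ suc) p m                              ≡⟨ count-cong (letterAt≡pairAt∨pairAt w b) p m ⟩
  count (λ i → pairAt w false b i ∨ pairAt w true b i) p m    ≡⟨ count-∨ (pairAt-disjoint w b b) p m ⟩
  count (pairAt w false b) p m + count (pairAt w true b) p m  ∎)
  where open ≡-Reasoning

AtMostOneAbove : ℕ → ℕ → Set
AtMostOneAbove x y = x ≡ y ⊎ x ≡ suc y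

AtMostOneAbove-suc : ∀ {x y} → AtMostOneAbove y x → AtMostOneAbove (suc x) y
AtMostOneAbove-suc (inj₁ refl) = inj₂ refl
AtMostOneAbove-suc (inj₂ refl) = inj₁ refl

AtMostOneAbove⇒halves : ∀ {x y} → AtMostOneAbove x y → x ≡ ⌈ x + y /2⌉ × y ≡ ⌊ x + y /2⌋
AtMostOneAbove⇒halves {y = y} (inj₁ refl) = n≡⌈n+n/2⌉ y , n≡⌊n+n/2⌋ y
AtMostOneAbove⇒halves {y = y} (inj₂ refl) = cong suc (n≡⌊n+n/2⌋ y) , n≡⌈n+n/2⌉ y

AtMostOneAbove-unique : ∀ {x y x′ y′} → AtMostOneAbove x y → AtMostOneAbove x′ y′ → x + y ≡ x′ + y′ →
                        x ≡ x′ × y ≡ y′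
AtMostOneAbove-unique h h′ sum≡ with AtMostOneAbove⇒halves h | AtMostOneAbove⇒halves h′
... | x≡ , y≡ | x′≡ , y′≡ =
  trans x≡ (trans (cong ⌈_/2⌉ sum≡) (sym x′≡)) , trans y≡ (trans (cong ⌊_/2⌋ sum≡) (sym y′≡))

Balanced : Bool → ℕ → ℕ → Set
Balanced false x y = AtMostOneAbove x y
Balanced true  x y = AtMostOneAbove y x

Balanced-unique : ∀ c {x y x′ y′} → Balanced c x y → Balanced c x′ y′ → x + y ≡ x′ + y′ →
                  x ≡ x′ × y ≡ y′
Balanced-unique false h h′ sum≡ = AtMostOneAbove-unique h h′ sum≡
Balanced-unique true {x} {y} {x′} {y′} h h′ sum≡ =
  let y≡y′ , x≡x′ = AtMostOneAbove-unique h h′ (trans (+-comm y x) (trans sum≡ (+-comm x′ y′)))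
  in  x≡x′ , y≡y′

-- In a binary word the changes 01 and 10 alternate, starting with one leaving the first letter.
changes-balanced : ∀ w p m → Balanced (w p) (count (pairAt w false true) p m) (count (pairAt w true false) p m)
changes-balanced w p zero with w p
... | false = inj₁ refl
... | true  = inj₁ refl
changes-balanced w p (suc m) with w p | w (suc p) | changes-balanced w (suc p) m
... | false | false | IH = IH
... | false | true  | IH = AtMostOneAbove-suc IH
... | true  | false | IH = AtMostOneAbove-suc IH
... | true  | true  | IH = IH

oddᵇ : ℕ → Bool
oddᵇ zero    = false
oddᵇ (suc n) = not (oddᵇ n)

oddᵇ-2* : ∀ k → oddᵇ (2 * k) ≡ false
oddᵇ-2* zero    = refl
oddᵇ-2* (suc k) = trans (cong oddᵇ (*-suc 2 k)) (cong (not ∘ not) (oddᵇ-2* k))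

squares-at-odd : ∀ i → ThueMorse i ≡ ThueMorse (suc i) → oddᵇ i ≡ true
squares-at-odd i square with evenOdd i
... | even k = ⊥-elim (not-¬ refl (trans (sym (thueMorse-even k)) (trans square (thueMorse-odd k))))
... | odd k  = cong not (oddᵇ-2* k)

twistedThueMorse : InfWord
twistedThueMorse i = ThueMorse i xor oddᵇ i

-- Squares of T sit at odd positions, where the twist turns a square cc into the change (not c) c.
square≡change : ∀ c i → pairAt ThueMorse c c i ≡ pairAt twistedThueMorse (not c) c i
square≡change c i = letters c (ThueMorse i) (ThueMorse (suc i)) (oddᵇ i) (squares-at-odd i)
  where
  letters : ∀ c a b q → (a ≡ b → q ≡ true) →
            does (a ≟ᵇ c) ∧ does (b ≟ᵇ c) ≡ does (a xor q ≟ᵇ not c) ∧ does (b xor not q ≟ᵇ c)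
  letters c     false false false odd-square with odd-square refl
  ... | ()
  letters c     true  true  false odd-square with odd-square refl
  ... | ()
  letters false false false true  _ = refl
  letters false false true  true  _ = refl
  letters false true  false true  _ = refl
  letters false true  true  true  _ = refl
  letters true  false false true  _ = refl
  letters true  false true  true  _ = refl
  letters true  true  false true  _ = refl
  letters true  true  true  true  _ = refl
  letters false false true  false _ = refl
  letters false true  false false _ = refl
  letters true  false true  false _ = refl
  letters true  true  false false _ = refl

squares-balanced : ∀ p m → Balanced (twistedThueMorse p) (count (pairAt ThueMorse true true) p m)
                                                        (count (pairAt ThueMorse false false) p m)
squares-balanced p m =
  subst₂ (Balanced (twistedThueMorse p)) (sym (count-cong (square≡change true) p m))
         (sym (count-cong (square≡change false) p m)) (changes-balanced twistedThueMorse p m)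

periodDoubling-letterAt : ∀ b i →
  letterAt PeriodDoubling b i ≡ pairAt ThueMorse false (not b) i ∨ pairAt ThueMorse true b i
periodDoubling-letterAt b i rewrite periodDoubling≡thueMorse-equal i with ThueMorse i | ThueMorse (suc i) | b
... | false | false | false = refl
... | false | false | true  = refl
... | false | true  | false = refl
... | false | true  | true  = refl
... | true  | false | false = refl
... | true  | false | true  = refl
... | true  | true  | false = refl
... | true  | true  | true  = refl

occ-periodDoubling : ∀ b p m →
  occ (b ∷ []) (factor PeriodDoubling p m) ≡ count (pairAt ThueMorse false (not b)) p m + count (pairAt ThueMorse true b) p m
occ-periodDoubling b p m = begin
  occ (b ∷ []) (factor PeriodDoubling p m)                                  ≡⟨ occ-letter PeriodDoubling b p m ⟩
  count (letterAt PeriodDoubling b) p m                                     ≡⟨ count-cong (periodDoubling-letterAt b) p m ⟩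
  count (λ i → pairAt ThueMorse false (not b) i ∨ pairAt ThueMorse true b i) p m
    ≡⟨ count-∨ (pairAt-disjoint ThueMorse (not b) b) p m ⟩
  count (pairAt ThueMorse false (not b)) p m + count (pairAt ThueMorse true b) p m ∎
  where open ≡-Reasoning

module _ (w : InfWord) {p q m : ℕ} where

  2Abelian⇒pairCount≡ : KAbelianEq 2 (factor w p (suc m)) (factor w q (suc m)) →
                        ∀ b b′ → count (pairAt w b b′) p m ≡ count (pairAt w b b′) q m
  2Abelian⇒pairCount≡ eq b b′ = begin
    count (pairAt w b b′) p m              ≡⟨ occ-pair w b b′ p m ⟨
    occ (b ∷ b′ ∷ []) (factor w p (suc m)) ≡⟨ eq (b ∷ b′ ∷ []) (s≤s z≤n) ≤-refl ⟩
    occ (b ∷ b′ ∷ []) (factor w q (suc m)) ≡⟨ occ-pair w b b′ q m ⟩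
    count (pairAt w b b′) q m              ∎
    where open ≡-Reasoning

  pairCount≡⇒2Abelian : w p ≡ w q → (∀ b b′ → count (pairAt w b b′) p m ≡ count (pairAt w b b′) q m) →
                        KAbelianEq 2 (factor w p (suc m)) (factor w q (suc m))
  pairCount≡⇒2Abelian first≡ pairs≡ (b ∷ []) _ _ = begin
    occ (b ∷ []) (factor w p (suc m))                      ≡⟨ occ-letter w b p (suc m) ⟩
    count (letterAt w b) p (suc m)                         ≡⟨ count-letter-by-predecessor w b p m ⟩
    indicator (letterAt w b p) + (count (pairAt w false b) p m + count (pairAt w true b) p m)
      ≡⟨ cong₂ _+_ (cong (λ c → indicator (does (c ≟ᵇ b))) first≡)
                   (cong₂ _+_ (pairs≡ false b) (pairs≡ true b)) ⟩
    indicator (letterAt w b q) + (count (pairAt w false b) q m + count (pairAt w true b) q m)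
      ≡⟨ count-letter-by-predecessor w b q m ⟨
    count (letterAt w b) q (suc m)                         ≡⟨ occ-letter w b q (suc m) ⟨
    occ (b ∷ []) (factor w q (suc m))                      ∎
    where open ≡-Reasoning
  pairCount≡⇒2Abelian first≡ pairs≡ (b ∷ b′ ∷ []) _ _ =
    trans (occ-pair w b b′ p m) (trans (pairs≡ b b′) (sym (occ-pair w b b′ q m)))
  pairCount≡⇒2Abelian first≡ pairs≡ (_ ∷ _ ∷ _ ∷ _) _ (s≤s (s≤s ()))

module _ {p q m : ℕ} where

  thueMorse-2Abelian⇒periodDoubling-Abelian :
    KAbelianEq 2 (factor ThueMorse p (suc m)) (factor ThueMorse q (suc m)) →
    KAbelianEq 1 (factor PeriodDoubling p m) (factor PeriodDoubling q m)
  thueMorse-2Abelian⇒periodDoubling-Abelian eq (b ∷ []) _ _ = begin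
    occ (b ∷ []) (factor PeriodDoubling p m)
      ≡⟨ occ-periodDoubling b p m ⟩
    count (pairAt ThueMorse false (not b)) p m + count (pairAt ThueMorse true b) p m
      ≡⟨ cong₂ _+_ (pairs≡ false (not b)) (pairs≡ true b) ⟩
    count (pairAt ThueMorse false (not b)) q m + count (pairAt ThueMorse true b) q m
      ≡⟨ occ-periodDoubling b q m ⟨
    occ (b ∷ []) (factor PeriodDoubling q m)
      ∎
    where
    open ≡-Reasoning
    pairs≡ : ∀ b b′ → count (pairAt ThueMorse b b′) p m ≡ count (pairAt ThueMorse b b′) q m
    pairs≡ = 2Abelian⇒pairCount≡ ThueMorse eq
  thueMorse-2Abelian⇒periodDoubling-Abelian eq (_ ∷ _ ∷ _) _ (s≤s ())

  periodDoubling-Abelian⇒thueMorse-2Abelian :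
    KAbelianEq 1 (factor PeriodDoubling p m) (factor PeriodDoubling q m) →
    ThueMorse p ≡ ThueMorse q → twistedThueMorse p ≡ twistedThueMorse q →
    KAbelianEq 2 (factor ThueMorse p (suc m)) (factor ThueMorse q (suc m))
  periodDoubling-Abelian⇒thueMorse-2Abelian eq first≡ twisted≡ = pairCount≡⇒2Abelian ThueMorse first≡ pairs≡
    where
    pairCount : Bool → Bool → ℕ → ℕ
    pairCount b b′ r = count (pairAt ThueMorse b b′) r m
    sums≡ : ∀ b → pairCount false (not b) p + pairCount true b p ≡ pairCount false (not b) q + pairCount true b q
    sums≡ b = trans (sym (occ-periodDoubling b p m)) (trans (eq (b ∷ []) (s≤s z≤n) ≤-refl) (occ-periodDoubling b q m))
    changes≡ : pairCount false true p ≡ pairCount false true q × pairCount true false p ≡ pairCount true false q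
    changes≡ = Balanced-unique (ThueMorse q) (subst (λ c → Balanced c _ _) first≡ (changes-balanced ThueMorse p m))
                 (changes-balanced ThueMorse q m) (sums≡ false)
    squares≡ : pairCount true true p ≡ pairCount true true q × pairCount false false p ≡ pairCount false false q
    squares≡ = Balanced-unique (twistedThueMorse q) (subst (λ c → Balanced c _ _) twisted≡ (squares-balanced p m))
                 (squares-balanced q m)
                 (trans (+-comm (pairCount true true p) _) (trans (sums≡ true) (+-comm _ (pairCount true true q))))
    pairs≡ : ∀ b b′ → pairCount b b′ p ≡ pairCount b b′ q
    pairs≡ false false = proj₂ squares≡
    pairs≡ false true  = proj₁ changes≡
    pairs≡ true  false = proj₂ changes≡
    pairs≡ true  true  = proj₁ squares≡

-- k-Abelian classes of factors

wordsOfLength : ℕ → List Word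
wordsOfLength zero    = [] ∷ []
wordsOfLength (suc n) = map (false ∷_) (wordsOfLength n) ++ map (true ∷_) (wordsOfLength n)

∈-wordsOfLength : ∀ x → x ∈ wordsOfLength (length x)
∈-wordsOfLength []          = here refl
∈-wordsOfLength (false ∷ x) = ∈-++⁺ˡ (∈-map⁺ (false ∷_) (∈-wordsOfLength x))
∈-wordsOfLength (true ∷ x)  = ∈-++⁺ʳ _ (∈-map⁺ (true ∷_) (∈-wordsOfLength x))

wordsOfLength-length : ∀ n → All (λ x → length x ≡ n) (wordsOfLength n)
wordsOfLength-length zero    = refl ∷ []
wordsOfLength-length (suc n) = All.++⁺ (extend false) (extend true)
  where
  extend : ∀ b → All (λ x → length x ≡ suc n) (map (b ∷_) (wordsOfLength n))
  extend b = All.map⁺ (All.map (cong suc) (wordsOfLength-length n))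

nonemptyWordsUpTo : ℕ → List Word
nonemptyWordsUpTo zero    = []
nonemptyWordsUpTo (suc k) = wordsOfLength (suc k) ++ nonemptyWordsUpTo k

∈-nonemptyWordsUpTo : ∀ {k} x → 1 ≤ length x → length x ≤ k → x ∈ nonemptyWordsUpTo k
∈-nonemptyWordsUpTo {suc k} x 1≤∣x∣ ∣x∣≤1+k with m≤n⇒m<n∨m≡n ∣x∣≤1+k
... | inj₁ (s≤s ∣x∣≤k) = ∈-++⁺ʳ (wordsOfLength (suc k)) (∈-nonemptyWordsUpTo x 1≤∣x∣ ∣x∣≤k)
... | inj₂ ∣x∣≡1+k     = ∈-++⁺ˡ (subst (λ n → x ∈ wordsOfLength n) ∣x∣≡1+k (∈-wordsOfLength x))
∈-nonemptyWordsUpTo {zero} (_ ∷ _) _ ()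

nonemptyWordsUpTo-length : ∀ k → All (λ x → 1 ≤ length x × length x ≤ k) (nonemptyWordsUpTo k)
nonemptyWordsUpTo-length zero    = []
nonemptyWordsUpTo-length (suc k) =
  All.++⁺ (All.map (λ ∣x∣≡1+k → subst (1 ≤_) (sym ∣x∣≡1+k) (s≤s z≤n) , ≤-reflexive ∣x∣≡1+k)
                   (wordsOfLength-length (suc k)))
          (All.map (λ (1≤∣x∣ , ∣x∣≤k) → 1≤∣x∣ , m≤n⇒m≤1+n ∣x∣≤k) (nonemptyWordsUpTo-length k))

signature : ℕ → Word → List ℕ
signature k u = map (λ x → occ x u) (nonemptyWordsUpTo k)

KAbelianEq⇒signature≡ : ∀ {k} u v → KAbelianEq k u v → signature k u ≡ signature k v
KAbelianEq⇒signature≡ {k} u v eq =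
  map-cong-local (All.map (λ {x} (1≤∣x∣ , ∣x∣≤k) → eq x 1≤∣x∣ ∣x∣≤k) (nonemptyWordsUpTo-length k))

signature≡⇒KAbelianEq : ∀ {k} u v → signature k u ≡ signature k v → KAbelianEq k u v
signature≡⇒KAbelianEq u v sig≡ x 1≤∣x∣ ∣x∣≤k =
  map≡map⇒≡ sig≡ (∈-nonemptyWordsUpTo x 1≤∣x∣ ∣x∣≤k)

module Representatives (w : InfWord) (k n bound : ℕ)
                       (recurrent : ∀ i → ∃ λ p → p < bound × factor w i n ≡ factor w p n) where

  signatureAt : ℕ → List ℕ
  signatureAt p = signature k (factor w p n)

  private
    sameSignature : DecSetoid _ _
    sameSignature = On.decSetoid (decSetoid (List-≡-dec _≟_)) signatureAt
    open DecSetoid sameSignature using () renaming (_≟_ to _≈?_; setoid to sameSignatureₛ)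

  classes : List ℕ
  classes = deduplicate _≈?_ (upTo bound)

  classes-distinct : AllPairs (λ r r′ → signatureAt r ≢ signatureAt r′) classes
  classes-distinct = deduplicate-! sameSignature (upTo bound)

  signatureAt-∈ : ∀ i → signatureAt i ∈ map signatureAt classes
  signatureAt-∈ i with recurrent i
  ... | p , p<bound , factor≡ = Any.map⁺ (Any.map (trans (cong (signature k) factor≡)) p∼classes)
    where
    p∼classes : Any (λ r → signatureAt p ≡ signatureAt r) classes
    p∼classes = SetoidMembership.∈-deduplicate⁺ sameSignatureₛ _≈?_ (λ r≈r′ p≈r → trans p≈r (sym r≈r′))
                  (Any.map (cong signatureAt) (∈-upTo⁺ p<bound))

  complexity : KAbelianComplexityIs w k n (length classes)
  complexity = map factorAt classes , length-map factorAt classes , all-factors , distinct , covered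
    where
    factorAt : ℕ → Word
    factorAt p = factor w p n
    all-factors : All (IsFactor w n) (map factorAt classes)
    all-factors = All.map⁺ (All.universal (λ r → r , refl) classes)
    distinct : AllPairs (λ u v → ¬ KAbelianEq k u v) (map factorAt classes)
    distinct = AllPairs.map⁺ (AllPairs.map
      (λ {r} {r′} sig≢ → sig≢ ∘ KAbelianEq⇒signature≡ (factorAt r) (factorAt r′)) classes-distinct)
    covered : ∀ i → Any (KAbelianEq k (factor w i n)) (map factorAt classes)
    covered i with ∈-map⁻ signatureAt (signatureAt-∈ i)
    ... | r , r∈ , sig≡ =
      Any.map⁺ (Any.map (λ { refl → signature≡⇒KAbelianEq (factorAt i) (factorAt r) sig≡ }) r∈)

bits : List Bool
bits = false ∷ true ∷ []

∈-bits : ∀ b → b ∈ bits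
∈-bits false = here refl
∈-bits true  = there (here refl)

module Classes (m : ℕ) where

  module TM = Representatives ThueMorse 2 (suc m) (2 ^ suc m * 6) (thueMorse-factor-recurrent (suc m))
  module PD = Representatives PeriodDoubling 1 m (2 ^ suc m * 6) (periodDoubling-factor-recurrent m)

  key : ℕ → List ℕ × Bool × Bool
  key r = PD.signatureAt r , ThueMorse r , twistedThueMorse r

  TM≡⇒PD≡ : ∀ r r′ → TM.signatureAt r ≡ TM.signatureAt r′ → PD.signatureAt r ≡ PD.signatureAt r′
  TM≡⇒PD≡ r r′ =
    KAbelianEq⇒signature≡ (factor PeriodDoubling r m) (factor PeriodDoubling r′ m)
    ∘ thueMorse-2Abelian⇒periodDoubling-Abelian {r} {r′}
    ∘ signature≡⇒KAbelianEq (factor ThueMorse r (suc m)) (factor ThueMorse r′ (suc m))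

  key≡⇒TM≡ : ∀ r r′ → key r ≡ key r′ → TM.signatureAt r ≡ TM.signatureAt r′
  key≡⇒TM≡ r r′ key≡ =
    KAbelianEq⇒signature≡ (factor ThueMorse r (suc m)) (factor ThueMorse r′ (suc m))
      (periodDoubling-Abelian⇒thueMorse-2Abelian {r} {r′}
        (signature≡⇒KAbelianEq (factor PeriodDoubling r m) (factor PeriodDoubling r′ m) (cong proj₁ key≡))
        (cong (proj₁ ∘ proj₂) key≡) (cong (proj₂ ∘ proj₂) key≡))

  periodDoubling-classes≤thueMorse-classes : length PD.classes ≤ length TM.classes
  periodDoubling-classes≤thueMorse-classes = begin
    length PD.classes                       ≡⟨ length-map PD.signatureAt PD.classes ⟨
    length (map PD.signatureAt PD.classes)  ≤⟨ unique-⊆⇒length-≤ (AllPairs.map⁺ PD.classes-distinct) PD⊆ ⟩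
    length (map PD.signatureAt TM.classes)  ≡⟨ length-map PD.signatureAt TM.classes ⟩
    length TM.classes                       ∎
    where
    open ≤-Reasoning
    PD⊆ : map PD.signatureAt PD.classes ⊆ map PD.signatureAt TM.classes
    PD⊆ = map-⊆ (λ r → ∈-map-through PD.signatureAt TM.signatureAt TM≡⇒PD≡ r (TM.signatureAt-∈ r))

  thueMorse-classes≤4*periodDoubling-classes : length TM.classes ≤ 4 * length PD.classes
  thueMorse-classes≤4*periodDoubling-classes = begin
    length TM.classes                               ≡⟨ length-map key TM.classes ⟨
    length (map key TM.classes)                     ≤⟨ unique-⊆⇒length-≤ keys-distinct keys⊆ ⟩
    length (cartesianProduct PD-signatures bits²)   ≡⟨ length-cartesianProduct PD-signatures bits² ⟩
    length PD-signatures * 4                        ≡⟨ cong (_* 4) (length-map PD.signatureAt PD.classes) ⟩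
    length PD.classes * 4                           ≡⟨ *-comm (length PD.classes) 4 ⟩
    4 * length PD.classes                           ∎
    where
    open ≤-Reasoning
    PD-signatures : List (List ℕ)
    PD-signatures = map PD.signatureAt PD.classes
    bits² : List (Bool × Bool)
    bits² = cartesianProduct bits bits
    keys-distinct : Unique (map key TM.classes)
    keys-distinct = AllPairs.map⁺ (AllPairs.map (λ {r} {r′} TM≢ → TM≢ ∘ key≡⇒TM≡ r r′) TM.classes-distinct)
    keys⊆ : map key TM.classes ⊆ cartesianProduct PD-signatures bits²
    keys⊆ = map-⊆ (λ r → ∈-cartesianProduct⁺ (PD.signatureAt-∈ r)
                                              (∈-cartesianProduct⁺ (∈-bits (ThueMorse r)) (∈-bits (twistedThueMorse r))))

lemma9 : (n : ℕ) → 2 ≤ n →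
    Σ ℕ λ a → Σ ℕ λ b →
        KAbelianComplexityIs PeriodDoubling 1 (n ∸ 1) a
      × KAbelianComplexityIs ThueMorse 2 n b
      × a ≤ b
      × b ≤ 4 * a
lemma9 zero ()
lemma9 (suc m) _ = length PD.classes , length TM.classes , PD.complexity , TM.complexity ,
                   periodDoubling-classes≤thueMorse-classes , thueMorse-classes≤4*periodDoubling-classes
  where open Classes m
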